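{- Let $\mathcal Q$ be a quasivariety. If every finitely presented algebra in $\mathcal Q$ is exact, then $\mathcal Q$ is universally complete.
   Context: For a quasivariety $\mathcal Q$, $\mathbf F_{\mathcal Q}(X)$ is the free algebra on $X$ and $\mathbf F_{\mathcal Q}(\omega)$ the free algebra on countably many generators. An algebra is finitely presented in $\mathcal Q$ if isomorphic to $\mathbf F_{\mathcal Q}(X)/\theta_{\mathcal Q}(H)$ with $X,H$ finite ($\theta_{\mathcal Q}(H)$ the least congruence containing $H$ with quotient in $\mathcal Q$). A finitely generated algebra of $\mathcal Q$ is exact iff it is isomorphic to a subalgebra of $\mathbf F_{\mathcal Q}(\omega)$. A universal sentence $\Sigma\Rightarrow\Delta$ ($\Sigma,\Delta$ finite sets of equations) is valid in an algebra if every assignment satisfying all of $\Sigma$ satisfies some equation of $\Delta$; it is admissible in $\mathcal Q$ if every substitution (homomorphism from terms to $\mathbf F_{\mathcal Q}(\omega)$) identifying both sides of every equation of $\Sigma$ identifies both sides of some equation of $\Delta$. $\mathcal Q$ is universally complete if every admissible universal sentence is valid in $\mathcal Q$. -}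

module Defs where

open import Level using (Level; _⊔_; 0ℓ) renaming (suc to lsuc)
open import Data.Nat using (ℕ)
open import Data.Fin using (Fin)
open import Data.List using (List; [])
open import Data.List.Membership.Propositional using (_∈_)
open import Data.List.Relation.Unary.Any using (Any)
open import Data.Product using (Σ; ∃; ∃-syntax; _×_; _,_; proj₁; proj₂)
open import Relation.Binary using (Rel; IsEquivalence)

record Signature : Set₁ where
  field
    Op    : Set
    arity : Op → ℕ

module _ (S : Signature) where
  open Signature S

  data Term (X : Set) : Set where
    var : X → Term X
    app : (f : Op) → (Fin (arity f) → Term X) → Term X

  Equation : Set → Set
  Equation X = Term X × Term X

  sub : {X Y : Set} → (X → Term Y) → Term X → Term Y
  sub σ (var x)    = σ x
  sub σ (app f ts) = app f (λ i → sub σ (ts i))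

  record QuasiIdentity : Set where
    field
      premises   : List (Equation ℕ)
      conclusion : Equation ℕ

  record Quasivariety : Set₁ where
    field
      Ax : Set
      ax : Ax → QuasiIdentity

  -- Algebras of the signature (setoid-based, so that quotients are available).
  record Algebra (a ℓ : Level) : Set (lsuc (a ⊔ ℓ)) where
    field
      Carrier       : Set a
      _≈_           : Rel Carrier ℓ
      isEquivalence : IsEquivalence _≈_
      op            : (f : Op) → (Fin (arity f) → Carrier) → Carrier
      op-cong       : ∀ f {xs ys : Fin (arity f) → Carrier} →
                      (∀ i → xs i ≈ ys i) → op f xs ≈ op f ys

    ⟦_⟧ : {X : Set} → Term X → (X → Carrier) → Carrier
    ⟦ var x ⟧    ρ = ρ x
    ⟦ app f ts ⟧ ρ = op f (λ i → ⟦ ts i ⟧ ρ)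

    _⊨_ : {X : Set} → (X → Carrier) → Equation X → Set ℓ
    ρ ⊨ e = ⟦ proj₁ e ⟧ ρ ≈ ⟦ proj₂ e ⟧ ρ

  open Algebra

  SatisfiesQI : ∀ {a ℓ} → Algebra a ℓ → QuasiIdentity → Set (a ⊔ ℓ)
  SatisfiesQI A q =
    (ρ : ℕ → Carrier A) →
    (∀ e → e ∈ QuasiIdentity.premises q → _⊨_ A ρ e) →
    _⊨_ A ρ (QuasiIdentity.conclusion q)

  _∈Q_ : ∀ {a ℓ} → Algebra a ℓ → Quasivariety → Set (a ⊔ ℓ)
  A ∈Q Q = (i : Quasivariety.Ax Q) → SatisfiesQI A (Quasivariety.ax Q i)

  record Hom {a ℓ b m} (A : Algebra a ℓ) (B : Algebra b m) : Set (a ⊔ ℓ ⊔ b ⊔ m) where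
    field
      map  : Carrier A → Carrier B
      cong : ∀ {x y} → _≈_ A x y → _≈_ B (map x) (map y)
      hom  : ∀ f (xs : Fin (arity f) → Carrier A) →
             _≈_ B (map (op A f xs)) (op B f (λ i → map (xs i)))

  record Embedding {a ℓ b m} (A : Algebra a ℓ) (B : Algebra b m) : Set (a ⊔ ℓ ⊔ b ⊔ m) where
    field
      homomorphism : Hom A B
      injective    : ∀ {x y} → _≈_ B (Hom.map homomorphism x) (Hom.map homomorphism y) →
                     _≈_ A x y

  record Iso {a ℓ b m} (A : Algebra a ℓ) (B : Algebra b m) : Set (a ⊔ ℓ ⊔ b ⊔ m) where
    field
      to      : Hom A B
      from    : Hom B A
      to-from : ∀ y → _≈_ B (Hom.map to (Hom.map from y)) y
      from-to : ∀ x → _≈_ A (Hom.map from (Hom.map to x)) x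

  module _ (Q : Quasivariety) where
    open Quasivariety Q

    -- H ⊢ s ≈ t : (s , t) lies in the least congruence of the term algebra on X
    -- containing H and closed under the quasi-identities of Q, i.e. the least
    -- congruence whose quotient lies in Q.  With H = [] this is the kernel of
    -- Term X → F_Q(X); in general Term X / (H ⊢_≈_) ≅ F_Q(X)/θ_Q(H).
    data _⊢_≈_ {X : Set} (H : List (Equation X)) : Term X → Term X → Set where
      hyp   : ∀ {s t} → (s , t) ∈ H → H ⊢ s ≈ t
      refl  : ∀ {s} → H ⊢ s ≈ s
      sym   : ∀ {s t} → H ⊢ s ≈ t → H ⊢ t ≈ s
      trans : ∀ {s t u} → H ⊢ s ≈ t → H ⊢ t ≈ u → H ⊢ s ≈ u
      cong  : ∀ f {ss ts : Fin (arity f) → Term X} →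
              (∀ i → H ⊢ ss i ≈ ts i) → H ⊢ app f ss ≈ app f ts
      axiom : (i : Ax) (σ : ℕ → Term X) →
              (∀ e → e ∈ QuasiIdentity.premises (ax i) →
                     H ⊢ sub σ (proj₁ e) ≈ sub σ (proj₂ e)) →
              H ⊢ sub σ (proj₁ (QuasiIdentity.conclusion (ax i)))
                ≈ sub σ (proj₂ (QuasiIdentity.conclusion (ax i)))

    Presented : (X : Set) → List (Equation X) → Algebra 0ℓ 0ℓ
    Presented X H = record
      { Carrier       = Term X
      ; _≈_           = H ⊢_≈_
      ; isEquivalence = record { refl = refl ; sym = sym ; trans = trans }
      ; op            = app
      ; op-cong       = cong
      }

    Free : Set → Algebra 0ℓ 0ℓ
    Free X = Presented X []

    FinitelyPresented : ∀ {a ℓ} → Algebra a ℓ → Set (a ⊔ ℓ)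
    FinitelyPresented A = Σ ℕ λ n → Σ (List (Equation (Fin n))) λ H →
                            Iso A (Presented (Fin n) H)

    -- Exact: isomorphic to a subalgebra of F_Q(ω), i.e. embeddable in F_Q(ω).
    Exact : ∀ {a ℓ} → Algebra a ℓ → Set (a ⊔ ℓ)
    Exact A = Embedding A (Free ℕ)

    record UniversalSentence : Set where
      field
        antecedent : List (Equation ℕ)
        succedent  : List (Equation ℕ)

    ValidIn : ∀ {a ℓ} → Algebra a ℓ → UniversalSentence → Set (a ⊔ ℓ)
    ValidIn A φ =
      (ρ : ℕ → Carrier A) →
      (∀ e → e ∈ UniversalSentence.antecedent φ → _⊨_ A ρ e) →
      Any (_⊨_ A ρ) (UniversalSentence.succedent φ)

    -- Admissible: every substitution into F_Q(ω) (a homomorphism from the term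
    -- algebra on ℕ to F_Q(ω), determined by the images of the variables)
    -- identifying Σ identifies some equation of Δ.
    Admissible : UniversalSentence → Set
    Admissible φ =
      (σ : ℕ → Term ℕ) →
      (∀ e → e ∈ UniversalSentence.antecedent φ → [] ⊢ sub σ (proj₁ e) ≈ sub σ (proj₂ e)) →
      Any (λ e → [] ⊢ sub σ (proj₁ e) ≈ sub σ (proj₂ e)) (UniversalSentence.succedent φ)

    UniversallyComplete : (a ℓ : Level) → Set (lsuc (a ⊔ ℓ))
    UniversallyComplete a ℓ =
      (φ : UniversalSentence) → Admissible φ →
      (A : Algebra a ℓ) → A ∈Q Q → ValidIn A φ

{-# OPTIONS --safe #-}
module Submission where

open import Defs
open import Level using (Level; 0ℓ)
open import Data.Nat using (ℕ; zero; suc; _≤_; _⊔_; s≤s)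
open import Data.Nat.Properties using (≤-refl; ≤-trans; m≤m⊔n; m≤n⊔m; m⊓n≤n; m≤n⇒m⊓n≡m)
open import Data.Fin using (Fin; toℕ; fromℕ<) renaming (zero to fzero; suc to fsuc)
open import Data.Fin.Properties using (toℕ-fromℕ<)
open import Data.List using (List; []; _∷_; map; _++_)
open import Data.List.Membership.Propositional using (_∈_; find; lose)
open import Data.List.Membership.Propositional.Properties using (∈-map⁺; ∈-map⁻; ∈-++⁺ˡ; ∈-++⁺ʳ)
open import Data.List.Relation.Unary.Any as Any using (Any; here; there)
open import Data.Product using (∃; _×_; _,_; proj₁; proj₂)
open import Function using (_∘_; _⇔_; mk⇔; Equivalence)
open import Relation.Binary using (Setoid)
import Relation.Binary.PropositionalEquality as ≡
import Relation.Binary.Reasoning.Setoid as SetoidReasoning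

-- Bound the variables of Σ ⇒ Δ by n and rename them into Fin (suc n); the renamed Σ
-- then presents a finitely presented algebra P, which by hypothesis embeds into F_Q(ω).
-- The images of the generators of P form a substitution σ identifying exactly the
-- equations that hold in P. As σ unifies Σ, admissibility gives an equation of Δ unified
-- by σ, hence derivable from Σ in Q, hence true in every algebra of Q wherever Σ is.

Upward : ∀ {p} → (ℕ → Set p) → Set p
Upward P = ∀ {m n} → m ≤ n → P m → P n

∃-⊔ : ∀ {p q} {P : ℕ → Set p} {Q : ℕ → Set q} →
      Upward P → Upward Q → ∃ P → ∃ Q → ∃ λ n → P n × Q n
∃-⊔ P↑ Q↑ (m , pm) (n , qn) = m ⊔ n , P↑ (m≤m⊔n m n) pm , Q↑ (m≤n⊔m m n) qn

module _ {a p} {A : Set a} {P : ℕ → A → Set p} (P↑ : ∀ {x} → Upward (λ n → P n x)) where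

  ∃-bound-Fin : ∀ {k} (xs : Fin k → A) → (∀ i → ∃ λ n → P n (xs i)) → ∃ λ n → ∀ i → P n (xs i)
  ∃-bound-Fin {zero}  xs bs = 0 , λ ()
  ∃-bound-Fin {suc k} xs bs
    with ∃-⊔ P↑ (λ le ps i → P↑ le (ps i)) (bs fzero) (∃-bound-Fin (xs ∘ fsuc) (bs ∘ fsuc))
  ... | n , p₀ , ps = n , λ { fzero → p₀ ; (fsuc i) → ps i }

  ∃-bound-List : (∀ x → ∃ λ n → P n x) → (xs : List A) → ∃ λ n → ∀ x → x ∈ xs → P n x
  ∃-bound-List bound []       = 0 , λ _ ()
  ∃-bound-List bound (x ∷ xs)
    with ∃-⊔ P↑ (λ le ps y y∈xs → P↑ le (ps y y∈xs)) (bound x) (∃-bound-List bound xs)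
  ... | n , px , pxs = n , λ { _ (here ≡.refl) → px ; y (there y∈xs) → pxs y y∈xs }

clamp : (n : ℕ) → ℕ → Fin (suc n)
clamp n x = fromℕ< (s≤s (m⊓n≤n x n))

toℕ-clamp : ∀ {n x} → x ≤ n → toℕ (clamp n x) ≡.≡ x
toℕ-clamp x≤n = ≡.trans (toℕ-fromℕ< _) (m≤n⇒m⊓n≡m x≤n)

module _ {S : Signature} where

  Bounded : ℕ → Term S ℕ → Set
  Bounded n (var x)    = x ≤ n
  Bounded n (app f ts) = ∀ i → Bounded n (ts i)

  Bounded-upward : ∀ t → Upward (λ n → Bounded n t)
  Bounded-upward (var x)    m≤n x≤m = ≤-trans x≤m m≤n
  Bounded-upward (app f ts) m≤n b i = Bounded-upward (ts i) m≤n (b i)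

  ∃-Bounded : ∀ t → ∃ λ n → Bounded n t
  ∃-Bounded (var x)    = x , ≤-refl
  ∃-Bounded (app f ts) = ∃-bound-Fin (λ {t} → Bounded-upward t) ts (λ i → ∃-Bounded (ts i))

  BoundedEq : ℕ → Equation S ℕ → Set
  BoundedEq n e = Bounded n (proj₁ e) × Bounded n (proj₂ e)

  BoundedEq-upward : ∀ e → Upward (λ n → BoundedEq n e)
  BoundedEq-upward (s , t) m≤n (bs , bt) = Bounded-upward s m≤n bs , Bounded-upward t m≤n bt

  ∃-BoundedEq : ∀ e → ∃ λ n → BoundedEq n e
  ∃-BoundedEq (s , t) = ∃-⊔ (Bounded-upward s) (Bounded-upward t) (∃-Bounded s) (∃-Bounded t)

  ∃-BoundedEqs : (es : List (Equation S ℕ)) → ∃ λ n → ∀ e → e ∈ es → BoundedEq n e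
  ∃-BoundedEqs = ∃-bound-List (λ {e} → BoundedEq-upward e) ∃-BoundedEq

  rename : {X Y : Set} → (X → Y) → Term S X → Term S Y
  rename r = sub S (var ∘ r)

  renameEq : {X Y : Set} → (X → Y) → Equation S X → Equation S Y
  renameEq r e = rename r (proj₁ e) , rename r (proj₂ e)

module _ {S : Signature} {a ℓ} (A : Algebra S a ℓ) where
  open Algebra A

  setoid : Setoid a ℓ
  setoid = record { Carrier = Carrier ; _≈_ = _≈_ ; isEquivalence = isEquivalence }

  open Setoid setoid using () renaming (refl to ≈-refl; sym to ≈-sym; trans to ≈-trans; reflexive to ≈-reflexive)
  open SetoidReasoning setoid

  Iso-refl : Iso S A A
  Iso-refl = record { to = id-hom ; from = id-hom ; to-from = λ _ → ≈-refl ; from-to = λ _ → ≈-refl }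
    where
    id-hom : Hom S A A
    id-hom = record { map = λ x → x ; cong = λ x≈y → x≈y ; hom = λ _ _ → ≈-refl }

  ⟦sub⟧ : {X Y : Set} (σ : X → Term S Y) (ρ : Y → Carrier) (t : Term S X) →
          ⟦ sub S σ t ⟧ ρ ≈ ⟦ t ⟧ (λ x → ⟦ σ x ⟧ ρ)
  ⟦sub⟧ σ ρ (var x)    = ≈-refl
  ⟦sub⟧ σ ρ (app f ts) = op-cong f (λ i → ⟦sub⟧ σ ρ (ts i))

  ⟦⟧-cong-Bounded : ∀ {n} {ρ ρ′ : ℕ → Carrier} → (∀ {x} → x ≤ n → ρ x ≈ ρ′ x) →
                    ∀ t → Bounded n t → ⟦ t ⟧ ρ ≈ ⟦ t ⟧ ρ′
  ⟦⟧-cong-Bounded ρ≈ρ′ (var x)    x≤n = ρ≈ρ′ x≤n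
  ⟦⟧-cong-Bounded ρ≈ρ′ (app f ts) b   = op-cong f (λ i → ⟦⟧-cong-Bounded ρ≈ρ′ (ts i) (b i))

  ⟦rename-clamp⟧ : ∀ {n} (ρ : ℕ → Carrier) t → Bounded n t →
                   ⟦ rename (clamp n) t ⟧ (ρ ∘ toℕ) ≈ ⟦ t ⟧ ρ
  ⟦rename-clamp⟧ ρ t b =
    ≈-trans (⟦sub⟧ _ _ t) (⟦⟧-cong-Bounded (λ x≤n → ≈-reflexive (≡.cong ρ (toℕ-clamp x≤n))) t b)

  ⊨-rename-clamp : ∀ {n} (ρ : ℕ → Carrier) e → BoundedEq n e →
                   ((ρ ∘ toℕ) ⊨ renameEq (clamp n) e) ⇔ (ρ ⊨ e)
  ⊨-rename-clamp ρ (s , t) (bs , bt) = mk⇔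
    (λ s≈t′ → ≈-trans (≈-sym (⟦rename-clamp⟧ ρ s bs)) (≈-trans s≈t′ (⟦rename-clamp⟧ ρ t bt)))
    (λ s≈t → ≈-trans (⟦rename-clamp⟧ ρ s bs) (≈-trans s≈t (≈-sym (⟦rename-clamp⟧ ρ t bt))))

  soundness : (Q : Quasivariety S) → _∈Q_ S A Q →
              ∀ {X} {H : List (Equation S X)} {ρ : X → Carrier} → (∀ e → e ∈ H → ρ ⊨ e) →
              ∀ {s t} → _⊢_≈_ S Q H s t → ⟦ s ⟧ ρ ≈ ⟦ t ⟧ ρ
  soundness Q A∈Q {ρ = ρ} ρ⊨H = sound
    where
    open Quasivariety Q
    sound : ∀ {s t} → _⊢_≈_ S Q _ s t → ⟦ s ⟧ ρ ≈ ⟦ t ⟧ ρ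
    sound (hyp s≈t∈H)  = ρ⊨H _ s≈t∈H
    sound refl         = ≈-refl
    sound (sym d)      = ≈-sym (sound d)
    sound (trans d d′) = ≈-trans (sound d) (sound d′)
    sound (cong f ds)  = op-cong f (λ i → sound (ds i))
    sound (axiom i σ ds) = begin
      ⟦ sub S σ l ⟧ ρ ≈⟨ ⟦sub⟧ σ ρ l ⟩
      ⟦ l ⟧ ρσ        ≈⟨ A∈Q i ρσ premises-hold ⟩
      ⟦ r ⟧ ρσ        ≈⟨ ⟦sub⟧ σ ρ r ⟨
      ⟦ sub S σ r ⟧ ρ ∎
      where
      l r : Term S ℕ
      l = proj₁ (QuasiIdentity.conclusion (ax i))
      r = proj₂ (QuasiIdentity.conclusion (ax i))
      ρσ : ℕ → Carrier
      ρσ x = ⟦ σ x ⟧ ρ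
      premises-hold : ∀ e → e ∈ QuasiIdentity.premises (ax i) → ρσ ⊨ e
      premises-hold e e∈ =
        ≈-trans (≈-sym (⟦sub⟧ σ ρ (proj₁ e))) (≈-trans (sound (ds e e∈)) (⟦sub⟧ σ ρ (proj₂ e)))

  clamped-soundness : (Q : Quasivariety S) → _∈Q_ S A Q →
    ∀ {n} (ρ : ℕ → Carrier) (Σ : List (Equation S ℕ)) →
    (∀ e → e ∈ Σ → BoundedEq n e) → (∀ e → e ∈ Σ → ρ ⊨ e) →
    ∀ e → BoundedEq n e →
    _⊢_≈_ S Q (map (renameEq (clamp n)) Σ) (rename (clamp n) (proj₁ e)) (rename (clamp n) (proj₂ e)) →
    ρ ⊨ e
  clamped-soundness Q A∈Q {n} ρ Σ bounded ρ⊨Σ e bounded-e derivable =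
    Equivalence.to (⊨-rename-clamp ρ e bounded-e) (soundness Q A∈Q ρ∘toℕ⊨H derivable)
    where
    ρ∘toℕ⊨H : ∀ e′ → e′ ∈ map (renameEq (clamp n)) Σ → (ρ ∘ toℕ) ⊨ e′
    ρ∘toℕ⊨H _ e′∈H with ∈-map⁻ (renameEq (clamp n)) e′∈H
    ... | e , e∈Σ , ≡.refl = Equivalence.from (⊨-rename-clamp ρ e (bounded e e∈Σ)) (ρ⊨Σ e e∈Σ)

module _ {S : Signature} (Q : Quasivariety S) where

  Presented-finitelyPresented : ∀ {n} (H : List (Equation S (Fin n))) →
                                FinitelyPresented S Q (Presented S Q (Fin n) H)
  Presented-finitelyPresented {n} H = n , H , Iso-refl _

  module _ {X Y : Set} {H : List (Equation S X)} {H′ : List (Equation S Y)} where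

    generators : Hom S (Presented S Q X H) (Presented S Q Y H′) → X → Term S Y
    generators h = Hom.map h ∘ var

    map-sub : ∀ {Z} (h : Hom S (Presented S Q X H) (Presented S Q Y H′)) (τ : Z → Term S X) t →
              _⊢_≈_ S Q H′ (Hom.map h (sub S τ t)) (sub S (Hom.map h ∘ τ) t)
    map-sub h τ (var z)    = refl
    map-sub h τ (app f ts) = trans (Hom.hom h f _) (cong f (λ i → map-sub h τ (ts i)))

    Embedding⇒rename⇔sub : ∀ {Z} (h : Embedding S (Presented S Q X H) (Presented S Q Y H′)) (r : Z → X) →
      let σ = generators (Embedding.homomorphism h) ∘ r in
      ∀ s t → _⊢_≈_ S Q H (rename r s) (rename r t) ⇔ _⊢_≈_ S Q H′ (sub S σ s) (sub S σ t)
    Embedding⇒rename⇔sub h r s t = mk⇔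
      (λ d → trans (sym (map-sub φ τ s)) (trans (Hom.cong φ d) (map-sub φ τ t)))
      (λ d → Embedding.injective h (trans (map-sub φ τ s) (trans d (sym (map-sub φ τ t)))))
      where
      φ = Embedding.homomorphism h
      τ = var ∘ r

  admissible⇒derivable : ∀ {X} (r : ℕ → X) (φ : UniversalSentence S Q) →
    let open UniversalSentence φ
        H = map (renameEq r) antecedent in
    Exact S Q (Presented S Q X H) → Admissible S Q φ →
    Any (λ e → _⊢_≈_ S Q H (rename r (proj₁ e)) (rename r (proj₂ e))) succedent
  admissible⇒derivable r φ h admissible =
    Any.map (λ {e} → Equivalence.from (Embedding⇒rename⇔sub h r (proj₁ e) (proj₂ e)))
            (admissible σ σ-unifies-antecedent)
    where
    open UniversalSentence φ
    σ : ℕ → Term S ℕ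
    σ = generators (Embedding.homomorphism h) ∘ r
    σ-unifies-antecedent : ∀ e → e ∈ antecedent → _⊢_≈_ S Q [] (sub S σ (proj₁ e)) (sub S σ (proj₂ e))
    σ-unifies-antecedent e e∈Σ =
      Equivalence.to (Embedding⇒rename⇔sub h r (proj₁ e) (proj₂ e)) (hyp (∈-map⁺ (renameEq r) e∈Σ))

theorem3p3 : (S : Signature) (Q : Quasivariety S) →
             ((A : Algebra S 0ℓ 0ℓ) → FinitelyPresented S Q A → Exact S Q A) →
             (a ℓ : Level) → UniversallyComplete S Q a ℓ
theorem3p3 S Q exact a ℓ φ admissible A A∈Q ρ ρ⊨Σ =
  let e , e∈Δ , derivable = find (admissible⇒derivable Q (clamp n) φ presentation-exact admissible)
  in lose e∈Δ (clamped-soundness A Q A∈Q ρ antecedent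
                 (λ e′ e′∈Σ → bounded e′ (∈-++⁺ˡ e′∈Σ)) ρ⊨Σ
                 e (bounded e (∈-++⁺ʳ antecedent e∈Δ)) derivable)
  where
  open UniversalSentence φ
  n : ℕ
  n = proj₁ (∃-BoundedEqs (antecedent ++ succedent))
  bounded : ∀ e → e ∈ antecedent ++ succedent → BoundedEq n e
  bounded = proj₂ (∃-BoundedEqs (antecedent ++ succedent))
  presentation-exact : Exact S Q (Presented S Q (Fin (suc n)) (map (renameEq (clamp n)) antecedent))
  presentation-exact = exact _ (Presented-finitelyPresented Q _)
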